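{- For $m\ge 1$ let $A_m$ be the number of distinct upward oriented patterns of side length $m$ occurring in the Sierpiński triangle $T$, and for $m\ge2$ let $B_m$, $C_m$, $D_m$ be the numbers of distinct top-cut, bottom-cut and all-cut upward patterns of side length $m$ occurring in $T$, respectively. Then for all $n\ge2$, $$A_n=C_{n+1}\quad\text{and}\quad B_n=D_{n+1}.$$
   Context: Unit triangles of an infinite equilateral triangular region (apex at the top) are indexed by $(r,c)$ with $r\ge0$ the row from the top and $0\le c\le 2r$ the column from the left; $(r,c)$ is upward if $c$ is even and downward if $c$ is odd. The Sierpiński triangle $T$ colours upward $(r,2j)$ filled iff $\binom{r}{j}$ is odd and every downward triangle unfilled (equivalently, $T$ is the limit of iterating, from a filled unit upward triangle, the substitution replacing an unfilled unit triangle by four unfilled ones and a filled upward unit triangle by a side-2 triangle with three filled corner triangles and an unfilled centre). For a position $(r,c)$ with $r\ge0$, $c$ even, $0\le c\le 2r$, and $m\ge1$, the upward pattern of side length $m$ at $(r,c)$ is the map $(i,k)\mapsto$ colour of $(r+i,c+k)$ on $S_m=\{(i,k):0\le i\le m-1,\ 0\le k\le 2i\}$. For $m\ge2$: the top-cut pattern at $(r,c)$ is the restriction of this map to $S_m\setminus\{(0,0)\}$; the bottom-cut pattern is its restriction to $S_m\setminus\{(m-1,0),(m-1,2m-2)\}$; the all-cut pattern is its restriction to $S_m\setminus\{(0,0),(m-1,0),(m-1,2m-2)\}$. Patterns of a given kind are counted as distinct maps, over all admissible positions $(r,c)$. -}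

module Defs where

open import Data.Bool using (Bool; true; false; if_then_else_; _∧_; _∨_; not)
open import Data.Nat using (ℕ; zero; suc; _+_; _*_; _∸_; _≤_; _≡ᵇ_)
open import Data.Nat.DivMod using (_%_; _/_)
open import Data.Nat.Combinatorics using (_C_)
open import Data.List using (List; []; _∷_; map; concatMap; upTo; filterᵇ; length)
open import Data.List.Relation.Unary.Unique.Propositional using (Unique)
open import Data.List.Membership.Propositional using (_∈_)
open import Data.Product using (_×_; _,_; Σ; ∃; ∃-syntax)
open import Function.Bundles using (_⇔_)
open import Relation.Binary.PropositionalEquality using (_≡_)

-- Colour of the unit triangle (r , c) in the Sierpinski triangle T:
-- true = filled.  Upward (c even) triangle (r , 2j) is filled iff
-- binom(r , j) is odd; downward triangles (c odd) are unfilled.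
colour : ℕ → ℕ → Bool
colour r c = if (c % 2) ≡ᵇ 0 then ((r C (c / 2)) % 2) ≡ᵇ 1 else false

S : ℕ → List (ℕ × ℕ)
S m = concatMap (λ i → map (λ k → (i , k)) (upTo (suc (2 * i)))) (upTo m)

cellEq : ℕ × ℕ → ℕ × ℕ → Bool
cellEq (i , k) (i' , k') = (i ≡ᵇ i') ∧ (k ≡ᵇ k')

topCutDom : ℕ → List (ℕ × ℕ)
topCutDom m = filterᵇ (λ x → not (cellEq x (0 , 0))) (S m)

bottomCutDom : ℕ → List (ℕ × ℕ)
bottomCutDom m =
  filterᵇ (λ x → not (cellEq x (m ∸ 1 , 0) ∨ cellEq x (m ∸ 1 , 2 * m ∸ 2))) (S m)

allCutDom : ℕ → List (ℕ × ℕ)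
allCutDom m =
  filterᵇ (λ x → not (cellEq x (0 , 0) ∨ cellEq x (m ∸ 1 , 0)
                      ∨ cellEq x (m ∸ 1 , 2 * m ∸ 2))) (S m)

-- A pattern on a finite domain D (a map D → Bool) is represented by the
-- list of its values along the canonical enumeration of D; two patterns
-- are equal as maps iff these lists are equal.
Pattern : Set
Pattern = List Bool

patternAt : List (ℕ × ℕ) → ℕ → ℕ → Pattern
patternAt D r c = map (λ { (i , k) → colour (r + i) (c + k) }) D

OccursWith : List (ℕ × ℕ) → Pattern → Set
OccursWith D p = ∃[ r ] ∃[ j ] (j ≤ r × patternAt D r (2 * j) ≡ p)

HasCount : (Pattern → Set) → ℕ → Set
HasCount P k =
  Σ (List Pattern) λ L → length L ≡ k × Unique L × (∀ p → P p ⇔ p ∈ L)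

IsA IsB IsC IsD : ℕ → ℕ → Set
IsA m k = HasCount (OccursWith (S m)) k
IsB m k = HasCount (OccursWith (topCutDom m)) k
IsC m k = HasCount (OccursWith (bottomCutDom m)) k
IsD m k = HasCount (OccursWith (allCutDom m)) k

-- Row r + 1 of T arises from row r by Pascal's rule mod 2: an upward cell of the
-- new row other than its two ends is the xor of the two upward cells above it, and
-- downward cells are unfilled. So the cells that a bottom-cut pattern of side n + 1
-- adds below an upward pattern of side n are a function of the latter, and the two
-- patterns at a position determine each other; likewise for top-cut and all-cut
-- patterns. Counting distinct patterns thus amounts to comparing two maps with the
-- same kernel on a finite list of positions. Finiteness comes from Lucas' theorem:
-- with M = 2^m, the side-m window at (r, 2j) is determined by r % M, j % M and three
-- entries of Pascal's triangle mod 2 near (r / M, j / M), whose eight possible values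
-- all occur in its first six rows, so every pattern occurs within the first 6M rows.
module Submission where

open import Defs
import Data.Bool
open import Data.Bool using (Bool; true; false; T; not; _∧_; _∨_; _xor_)
open import Data.Unit using (tt)
open import Data.Bool.Properties
  using (T?; T-∧; T-∨; T-not-≡; ∨-identityʳ; xor-comm; xor-assoc; xor-same; xor-identityʳ; ∧-distribʳ-xor)
open import Data.Nat using (ℕ; zero; suc; _+_; _*_; _^_; _∸_; _≤_; _<_; _≡ᵇ_; z≤n; s≤s; NonZero)
open import Data.Nat.Properties
open import Algebra.Properties.CommutativeSemigroup +-commutativeSemigroup using (xy∙z≈y∙zx)
open import Data.Nat.DivMod using (_%_; _/_; m≡m%n+[m/n]*n; m%n<n; m*n%n≡0; m*n/n≡m; %-distribˡ-+)
open import Data.Nat.Combinatorics using (_C_; nCk+nC[k+1]≡[n+1]C[k+1])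
open import Data.List using (List; []; _∷_; _++_; map; concatMap; upTo; filterᵇ; length)
open import Data.List.Properties
  using (≡-dec; filter-++; filter-all; concatMap-++; upTo-∷ʳ; ++-identityʳ; map-cong-local; ∷-injectiveˡ; ∷-injectiveʳ)
open import Data.List.Membership.Propositional using (_∈_; _∉_; find; lose)
open import Data.List.Membership.Propositional.Properties
  using (∈-map⁺; ∈-map⁻; ∈-concatMap⁺; ∈-concatMap⁻; ∈-upTo⁺; ∈-upTo⁻; ∈-filter⁺; ∈-filter⁻)
open import Data.List.Relation.Unary.All as All using (All; []; _∷_)
open import Data.List.Relation.Unary.All.Properties using (anti-mono; ++⁺; ++⁻)
open import Data.List.Relation.Unary.All.Properties.Core using (¬Any⇒All¬)
open import Data.List.Relation.Unary.Any using (here; there)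
open import Data.List.Relation.Unary.Unique.Propositional using (Unique)
open import Data.List.Relation.Unary.AllPairs using ([]; _∷_)
open import Data.List.Relation.Binary.Subset.Propositional using (_⊆_)
open import Data.List.Relation.Binary.Subset.Propositional.Properties using (xs⊆xs++ys; filter-⊆)
open import Data.List.Membership.DecPropositional (≡-dec Data.Bool._≟_) using (_∈?_)
open import Data.Product using (_×_; _,_; proj₁; proj₂; ∃-syntax)
open import Data.Sum using (_⊎_; inj₁; inj₂)
open import Function using (_∘_)
open import Function.Bundles using (_⇔_; mk⇔; Equivalence)
open import Function.Construct.Composition using (_⇔-∘_)
open import Function.Construct.Symmetry using (⇔-sym)
open import Relation.Binary.PropositionalEquality
open import Relation.Nullary using (yes; no; ¬_)

xor-cancel-middle : ∀ a b c → (a xor b) xor (b xor c) ≡ a xor c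
xor-cancel-middle a b c = begin
  (a xor b) xor (b xor c)  ≡⟨ xor-assoc a b (b xor c) ⟩
  a xor (b xor (b xor c))  ≡⟨ cong (a xor_) (xor-assoc b b c) ⟨
  a xor ((b xor b) xor c)  ≡⟨ cong (λ z → a xor (z xor c)) (xor-same b) ⟩
  a xor c                  ∎
  where open ≡-Reasoning

data Parity : ℕ → Set where
  even : ∀ t → Parity (2 * t)
  odd  : ∀ t → Parity (suc (2 * t))

parity : ∀ k → Parity k
parity zero = even 0
parity (suc k) with parity k
... | even t = odd t
... | odd t  = subst Parity (*-suc 2 t) (even (suc t))

<+-split : ∀ M {u} → u < M + M → u < M ⊎ ∃[ u' ] (u' < M × u ≡ M + u')
<+-split M {u} u<M+M with u <? M
... | yes u<M = inj₁ u<M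
... | no u≮M  = inj₂ (u ∸ M , +-cancelˡ-< M (u ∸ M) M (subst (_< M + M) u≡ u<M+M) , u≡)
  where
    u≡ : u ≡ M + (u ∸ M)
    u≡ = sym (m+[n∸m]≡n (≮⇒≥ u≮M))

x*M+[M+w]≡[1+x]*M+w : ∀ x M w → x * M + (M + w) ≡ suc x * M + w
x*M+[M+w]≡[1+x]*M+w x M w = trans (sym (+-assoc (x * M) M w)) (cong (_+ w) (+-comm (x * M) M))

n<2^n : ∀ n → n < 2 ^ n
n<2^n zero    = s≤s z≤n
n<2^n (suc n) = begin-strict
  suc n            ≡⟨ +-identityʳ (suc n) ⟨
  suc n + 0        <⟨ +-mono-≤-< (n<2^n n) (m^n>0 2 n) ⟩
  2 ^ n + 2 ^ n    ≡⟨ cong (2 ^ n +_) (+-identityʳ (2 ^ n)) ⟨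
  2 ^ suc n        ∎
  where open ≤-Reasoning

map-≡⇒All : ∀ {A B : Set} {f g : A → B} xs → map f xs ≡ map g xs → All (λ x → f x ≡ g x) xs
map-≡⇒All []       _  = []
map-≡⇒All (x ∷ xs) eq = ∷-injectiveˡ eq ∷ map-≡⇒All xs (∷-injectiveʳ eq)

filterᵇ-cong-local : ∀ {A : Set} {p q : A → Bool} xs → (∀ {x} → x ∈ xs → p x ≡ q x) →
                     filterᵇ p xs ≡ filterᵇ q xs
filterᵇ-cong-local []       _   = refl
filterᵇ-cong-local {p = p} {q} (x ∷ xs) p≗q with p x | q x | p≗q (here refl)
... | true  | true  | refl = cong (x ∷_) (filterᵇ-cong-local xs (p≗q ∘ there))
... | false | false | refl = filterᵇ-cong-local xs (p≗q ∘ there)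

-- S m is staircase (λ i → suc (2 * i)) m by definition.
staircase : (ℕ → ℕ) → ℕ → List (ℕ × ℕ)
staircase w n = concatMap (λ i → map (i ,_) (upTo (w i))) (upTo n)

∈-staircase⁺ : ∀ w n {i k} → i < n → k < w i → (i , k) ∈ staircase w n
∈-staircase⁺ w n {i} i<n k<w =
  ∈-concatMap⁺ (λ i → map (i ,_) (upTo (w i)))
    (lose (∈-upTo⁺ i<n) (∈-map⁺ (i ,_) (∈-upTo⁺ k<w)))

∈-staircase⁻ : ∀ w n {i k} → (i , k) ∈ staircase w n → i < n × k < w i
∈-staircase⁻ w n ik∈ with find (∈-concatMap⁻ (λ i → map (i ,_) (upTo (w i))) {xs = upTo n} ik∈)
... | i , i∈ , ik∈row with ∈-map⁻ (i ,_) ik∈row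
... | k , k∈ , refl = ∈-upTo⁻ i∈ , ∈-upTo⁻ k∈

Dedup : List Pattern → List Pattern → Set
Dedup xs L = Unique L × (∀ p → p ∈ xs ⇔ p ∈ L)

dedup-[] : Dedup [] []
dedup-[] = [] , λ p → mk⇔ (λ ()) (λ ())

dedup-∷-∈ : ∀ {x xs L} → Dedup xs L → x ∈ L → Dedup (x ∷ xs) L
dedup-∷-∈ {x} {xs} {L} (unique , same) x∈L =
  unique , λ p → mk⇔ (to p) (there ∘ Equivalence.from (same p))
  where
    to : ∀ p → p ∈ x ∷ xs → p ∈ L
    to p (here refl) = x∈L
    to p (there p∈) = Equivalence.to (same p) p∈

dedup-∷-∉ : ∀ {x xs L} → Dedup xs L → x ∉ L → Dedup (x ∷ xs) (x ∷ L)
dedup-∷-∉ {x} {xs} {L} (unique , same) x∉L =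
  ¬Any⇒All¬ L x∉L ∷ unique , λ p → mk⇔ (to p) (from p)
  where
    to : ∀ p → p ∈ x ∷ xs → p ∈ x ∷ L
    to p (here p≡x) = here p≡x
    to p (there p∈) = there (Equivalence.to (same p) p∈)
    from : ∀ p → p ∈ x ∷ L → p ∈ x ∷ xs
    from p (here p≡x) = here p≡x
    from p (there p∈) = there (Equivalence.from (same p) p∈)

∈-map-transfer : ∀ {A B C : Set} {f : A → B} {g : A → C} → (∀ x y → f x ≡ f y → g x ≡ g y) →
                 ∀ {x} xs → f x ∈ map f xs → g x ∈ map g xs
∈-map-transfer {f = f} {g} f⇒g xs fx∈ with ∈-map⁻ f fx∈
... | y , y∈ , fx≡fy = subst (_∈ map g xs) (sym (f⇒g _ y fx≡fy)) (∈-map⁺ g y∈)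

module _ {A : Set} (f g : A → Pattern) (same-kernel : ∀ x y → f x ≡ f y ⇔ g x ≡ g y) where

  private
    f⇒g : ∀ x y → f x ≡ f y → g x ≡ g y
    f⇒g x y = Equivalence.to (same-kernel x y)
    g⇒f : ∀ x y → g x ≡ g y → f x ≡ f y
    g⇒f x y = Equivalence.from (same-kernel x y)

  same-kernel⇒dedup : ∀ xs →
    ∃[ L ] ∃[ L' ] (length L ≡ length L' × Dedup (map f xs) L × Dedup (map g xs) L')
  same-kernel⇒dedup [] = [] , [] , refl , dedup-[] , dedup-[]
  same-kernel⇒dedup (x ∷ xs) with same-kernel⇒dedup xs
  ... | L , L' , |L|≡|L'| , dedupF@(_ , sameF) , dedupG@(_ , sameG) with f x ∈? L
  ... | yes fx∈L = L , L' , |L|≡|L'| , dedup-∷-∈ dedupF fx∈L , dedup-∷-∈ dedupG gx∈L'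
    where
      gx∈L' : g x ∈ L'
      gx∈L' = Equivalence.to (sameG (g x))
                (∈-map-transfer f⇒g xs (Equivalence.from (sameF (f x)) fx∈L))
  ... | no fx∉L =
    f x ∷ L , g x ∷ L' , cong suc |L|≡|L'| , dedup-∷-∉ dedupF fx∉L , dedup-∷-∉ dedupG gx∉L'
    where
      gx∉L' : g x ∉ L'
      gx∉L' gx∈L' = fx∉L (Equivalence.to (sameF (f x))
                      (∈-map-transfer g⇒f xs (Equivalence.from (sameG (g x)) gx∈L')))

  same-kernel⇒same-count : ∀ xs → ∃[ k ] (HasCount (_∈ map f xs) k × HasCount (_∈ map g xs) k)
  same-kernel⇒same-count xs with same-kernel⇒dedup xs
  ... | L , L' , |L|≡|L'| , (uniqueL , sameL) , (uniqueL' , sameL') =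
    length L , (L , refl , uniqueL , sameL) , (L' , sym |L|≡|L'| , uniqueL' , sameL')

HasCount-resp-⇔ : ∀ {P Q : Pattern → Set} {k} → (∀ p → P p ⇔ Q p) → HasCount Q k → HasCount P k
HasCount-resp-⇔ P⇔Q (L , |L|≡k , unique , Q⇔∈L) =
  L , |L|≡k , unique , λ p → Q⇔∈L p ⇔-∘ P⇔Q p

pascal₂ : ℕ → ℕ → Bool
pascal₂ zero    zero    = true
pascal₂ zero    (suc j) = false
pascal₂ (suc r) zero    = true
pascal₂ (suc r) (suc j) = pascal₂ r j xor pascal₂ r (suc j)

pascal₂-zeroʳ : ∀ r → pascal₂ r 0 ≡ true
pascal₂-zeroʳ zero    = refl
pascal₂-zeroʳ (suc r) = refl

<⇒pascal₂≡false : ∀ {r j} → r < j → pascal₂ r j ≡ false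
<⇒pascal₂≡false {zero}  {suc j} _         = refl
<⇒pascal₂≡false {suc r} {suc j} (s≤s r<j)
  rewrite <⇒pascal₂≡false r<j | <⇒pascal₂≡false (m<n⇒m<1+n r<j) = refl

isOdd : ℕ → Bool
isOdd n = n % 2 ≡ᵇ 1

isOdd-suc : ∀ n → isOdd (suc n) ≡ not (isOdd n)
isOdd-suc zero          = refl
isOdd-suc (suc zero)    = refl
isOdd-suc (suc (suc n)) = isOdd-suc n

isOdd-+ : ∀ m n → isOdd (m + n) ≡ isOdd m xor isOdd n
isOdd-+ zero          n = refl
isOdd-+ (suc zero)    n = isOdd-suc n
isOdd-+ (suc (suc m)) n = isOdd-+ m n

isOdd-C≡pascal₂ : ∀ r j → isOdd (r C j) ≡ pascal₂ r j
isOdd-C≡pascal₂ zero    zero    = refl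
isOdd-C≡pascal₂ zero    (suc j) = refl
isOdd-C≡pascal₂ (suc r) zero    = refl
isOdd-C≡pascal₂ (suc r) (suc j) = begin
  isOdd (suc r C suc j)                ≡⟨ cong isOdd (nCk+nC[k+1]≡[n+1]C[k+1] r j) ⟨
  isOdd (r C j + r C suc j)            ≡⟨ isOdd-+ (r C j) (r C suc j) ⟩
  isOdd (r C j) xor isOdd (r C suc j)  ≡⟨ cong₂ _xor_ (isOdd-C≡pascal₂ r j) (isOdd-C≡pascal₂ r (suc j)) ⟩
  pascal₂ r j xor pascal₂ r (suc j)    ∎
  where open ≡-Reasoning

[2*j]%2≡0 : ∀ j → 2 * j % 2 ≡ 0
[2*j]%2≡0 j = trans (cong (_% 2) (*-comm 2 j)) (m*n%n≡0 j 2)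

[2*j]/2≡j : ∀ j → 2 * j / 2 ≡ j
[2*j]/2≡j j = trans (cong (_/ 2) (*-comm 2 j)) (m*n/n≡m j 2)

colour-2* : ∀ r j → colour r (2 * j) ≡ pascal₂ r j
colour-2* r j rewrite [2*j]%2≡0 j | [2*j]/2≡j j = isOdd-C≡pascal₂ r j

[1+2*j]%2≡1 : ∀ j → suc (2 * j) % 2 ≡ 1
[1+2*j]%2≡1 j = trans (%-distribˡ-+ 1 (2 * j) 2) (cong (λ z → (1 + z) % 2) ([2*j]%2≡0 j))

colour-1+2* : ∀ r j → colour r (suc (2 * j)) ≡ false
colour-1+2* r j rewrite [1+2*j]%2≡1 j = refl

colour-2*+2* : ∀ r j t → colour r (2 * j + 2 * t) ≡ pascal₂ r (j + t)
colour-2*+2* r j t = trans (cong (colour r) (sym (*-distribˡ-+ 2 j t))) (colour-2* r (j + t))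

colour-2*+1+2* : ∀ r j t → colour r (2 * j + suc (2 * t)) ≡ false
colour-2*+1+2* r j t =
  trans (cong (colour r) (trans (+-suc (2 * j) (2 * t)) (cong suc (sym (*-distribˡ-+ 2 j t)))))
        (colour-1+2* r (j + t))

-- Multiplication by x^M: shift M f j = f (j ∸ M) for M ≤ j, and false for j < M.
shift : ℕ → (ℕ → Bool) → ℕ → Bool
shift zero    f j       = f j
shift (suc M) f zero    = false
shift (suc M) f (suc j) = shift M f j

shift-< : ∀ {M j} f → j < M → shift M f j ≡ false
shift-< {suc M} {zero}  f _         = refl
shift-< {suc M} {suc j} f (s≤s j<M) = shift-< f j<M

shift-+ : ∀ M f j → shift M f (M + j) ≡ f j
shift-+ zero    f j = refl
shift-+ (suc M) f j = shift-+ M f j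

shift-cong : ∀ M {f g : ℕ → Bool} → (∀ j → f j ≡ g j) → ∀ j → shift M f j ≡ shift M g j
shift-cong zero    f≗g j       = f≗g j
shift-cong (suc M) f≗g zero    = refl
shift-cong (suc M) f≗g (suc j) = shift-cong M f≗g j

shift-xor : ∀ M f g j → shift M (λ i → f i xor g i) j ≡ shift M f j xor shift M g j
shift-xor zero    f g j       = refl
shift-xor (suc M) f g zero    = refl
shift-xor (suc M) f g (suc j) = shift-xor M f g j

shift-shift : ∀ M N f j → shift M (shift N f) j ≡ shift (M + N) f j
shift-shift zero    N f j       = refl
shift-shift (suc M) N f zero    = refl
shift-shift (suc M) N f (suc j) = shift-shift M N f j

-- (1 + x)^(r + M) = (1 + x)^r (1 + x^M) over 𝔽₂; true whenever M is a power of two.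
Frobenius : ℕ → Set
Frobenius M = ∀ r j → pascal₂ (r + M) j ≡ pascal₂ r j xor shift M (pascal₂ r) j

frobenius-1 : Frobenius 1
frobenius-1 r zero    rewrite +-comm r 1 | pascal₂-zeroʳ r = refl
frobenius-1 r (suc j) rewrite +-comm r 1 = xor-comm (pascal₂ r j) (pascal₂ r (suc j))

frobenius-+ : ∀ {M} → Frobenius M → Frobenius (M + M)
frobenius-+ {M} frob r j = begin
  pascal₂ (r + (M + M)) j
    ≡⟨ cong (λ s → pascal₂ s j) (+-assoc r M M) ⟨
  pascal₂ (r + M + M) j
    ≡⟨ frob (r + M) j ⟩
  p (r + M) j xor shift M (p (r + M)) j
    ≡⟨ cong₂ _xor_ (frob r j) (shift-cong M (frob r) j) ⟩
  (p r j xor shift M (p r) j) xor shift M (λ i → p r i xor shift M (p r) i) j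
    ≡⟨ cong ((p r j xor shift M (p r) j) xor_) (shift-xor M (p r) (shift M (p r)) j) ⟩
  (p r j xor shift M (p r) j) xor (shift M (p r) j xor shift M (shift M (p r)) j)
    ≡⟨ xor-cancel-middle (p r j) (shift M (p r) j) (shift M (shift M (p r)) j) ⟩
  p r j xor shift M (shift M (p r)) j
    ≡⟨ cong (p r j xor_) (shift-shift M M (p r) j) ⟩
  p r j xor shift (M + M) (p r) j ∎
  where
    open ≡-Reasoning
    p : ℕ → ℕ → Bool
    p = pascal₂

frobenius-2^ : ∀ k → Frobenius (2 ^ k)
frobenius-2^ zero    = frobenius-1
frobenius-2^ (suc k) =
  subst Frobenius (cong (2 ^ k +_) (sym (+-identityʳ (2 ^ k)))) (frobenius-+ (frobenius-2^ k))

lucas : ∀ {M} → Frobenius M → ∀ q σ {a b} → a < M → b < M →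
        pascal₂ (q * M + a) (σ * M + b) ≡ pascal₂ q σ ∧ pascal₂ a b
lucas frob zero zero    a<M b<M = refl
lucas {M} frob zero (suc σ) {a} {b} a<M b<M =
  <⇒pascal₂≡false (≤-trans a<M (≤-trans (m≤m+n M (σ * M)) (m≤m+n _ b)))
lucas {M} frob (suc q) σ {a} {b} a<M b<M = begin
  pascal₂ (M + q * M + a) (σ * M + b)
    ≡⟨ cong (λ s → pascal₂ s (σ * M + b)) (+-comm-middle) ⟩
  pascal₂ (q * M + a + M) (σ * M + b)
    ≡⟨ frob (q * M + a) (σ * M + b) ⟩
  pascal₂ (q * M + a) (σ * M + b) xor shift M (pascal₂ (q * M + a)) (σ * M + b)
    ≡⟨ new-row σ ⟩
  pascal₂ (suc q) σ ∧ pascal₂ a b ∎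
  where
    open ≡-Reasoning
    +-comm-middle : M + q * M + a ≡ q * M + a + M
    +-comm-middle = trans (xy∙z≈y∙zx M (q * M) a) (sym (+-assoc (q * M) a M))
    new-row : ∀ σ → pascal₂ (q * M + a) (σ * M + b) xor shift M (pascal₂ (q * M + a)) (σ * M + b)
                    ≡ pascal₂ (suc q) σ ∧ pascal₂ a b
    new-row zero = begin
      pascal₂ (q * M + a) b xor shift M (pascal₂ (q * M + a)) b
        ≡⟨ cong₂ _xor_ (lucas frob q zero a<M b<M) (shift-< (pascal₂ (q * M + a)) b<M) ⟩
      (pascal₂ q 0 ∧ pascal₂ a b) xor false
        ≡⟨ xor-identityʳ _ ⟩
      pascal₂ q 0 ∧ pascal₂ a b
        ≡⟨ cong (_∧ pascal₂ a b) (pascal₂-zeroʳ q) ⟩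
      pascal₂ a b ∎
    new-row (suc σ) = begin
      pascal₂ (q * M + a) (suc σ * M + b) xor shift M (pascal₂ (q * M + a)) (M + σ * M + b)
        ≡⟨ cong (pascal₂ (q * M + a) (suc σ * M + b) xor_)
                (trans (cong (shift M _) (+-assoc M (σ * M) b)) (shift-+ M _ (σ * M + b))) ⟩
      pascal₂ (q * M + a) (suc σ * M + b) xor pascal₂ (q * M + a) (σ * M + b)
        ≡⟨ cong₂ _xor_ (lucas frob q (suc σ) a<M b<M) (lucas frob q σ a<M b<M) ⟩
      (pascal₂ q (suc σ) ∧ pascal₂ a b) xor (pascal₂ q σ ∧ pascal₂ a b)
        ≡⟨ ∧-distribʳ-xor (pascal₂ a b) (pascal₂ q (suc σ)) (pascal₂ q σ) ⟨
      (pascal₂ q (suc σ) xor pascal₂ q σ) ∧ pascal₂ a b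
        ≡⟨ cong (_∧ pascal₂ a b) (xor-comm (pascal₂ q (suc σ)) (pascal₂ q σ)) ⟩
      pascal₂ (suc q) (suc σ) ∧ pascal₂ a b ∎

-- The three entries of Pascal's triangle mod 2 that, by Lucas' theorem, determine
-- the blocks (q, σ), (q, σ + 1), (q + 1, σ), (q + 1, σ + 1) at scale M.
corner : ℕ → ℕ → Bool × Bool × Bool
corner q σ = pascal₂ q σ , pascal₂ q (suc σ) , pascal₂ (suc q) σ

module _ {M} (frob : Frobenius M) where

  lucas-block : ∀ x y x' y' → pascal₂ x y ≡ pascal₂ x' y' → ∀ {a b} → a < M → b < M →
                pascal₂ (x * M + a) (y * M + b) ≡ pascal₂ (x' * M + a) (y' * M + b)
  lucas-block x y x' y' e {a} {b} a<M b<M = begin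
    pascal₂ (x * M + a) (y * M + b)    ≡⟨ lucas frob x y a<M b<M ⟩
    pascal₂ x y ∧ pascal₂ a b          ≡⟨ cong (_∧ pascal₂ a b) e ⟩
    pascal₂ x' y' ∧ pascal₂ a b        ≡⟨ lucas frob x' y' a<M b<M ⟨
    pascal₂ (x' * M + a) (y' * M + b)  ∎
    where open ≡-Reasoning

  corner-determines : ∀ q σ q' σ' → corner q σ ≡ corner q' σ' →
                      ∀ {u v} → u < M + M → v < M + M →
                      pascal₂ (q * M + u) (σ * M + v) ≡ pascal₂ (q' * M + u) (σ' * M + v)
  corner-determines q σ q' σ' eq {u} {v} u< v<
    with <+-split M u< | <+-split M v<
  ... | inj₁ u<M | inj₁ v<M =
    lucas-block q σ q' σ' (cong proj₁ eq) u<M v<M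
  ... | inj₁ u<M | inj₂ (v' , v'<M , refl)
    rewrite x*M+[M+w]≡[1+x]*M+w σ M v' | x*M+[M+w]≡[1+x]*M+w σ' M v' =
    lucas-block q (suc σ) q' (suc σ') (cong (proj₁ ∘ proj₂) eq) u<M v'<M
  ... | inj₂ (u' , u'<M , refl) | inj₁ v<M
    rewrite x*M+[M+w]≡[1+x]*M+w q M u' | x*M+[M+w]≡[1+x]*M+w q' M u' =
    lucas-block (suc q) σ (suc q') σ' (cong (proj₂ ∘ proj₂) eq) u'<M v<M
  ... | inj₂ (u' , u'<M , refl) | inj₂ (v' , v'<M , refl)
    rewrite x*M+[M+w]≡[1+x]*M+w q M u' | x*M+[M+w]≡[1+x]*M+w q' M u'
          | x*M+[M+w]≡[1+x]*M+w σ M v' | x*M+[M+w]≡[1+x]*M+w σ' M v' =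
    lucas-block (suc q) (suc σ) (suc q') (suc σ')
      (cong₂ _xor_ (cong proj₁ eq) (cong (proj₁ ∘ proj₂) eq)) u'<M v'<M

corner-representative : ∀ c → ∃[ q ] ∃[ σ ] (σ < q × q ≤ 5 × corner q σ ≡ c)
corner-representative (false , false , false) = 4 , 2 , <ᵇ⇒< 2 4 _ , ≤ᵇ⇒≤ 4 5 _ , refl
corner-representative (false , false , true)  = 4 , 1 , <ᵇ⇒< 1 4 _ , ≤ᵇ⇒≤ 4 5 _ , refl
corner-representative (false , true  , false) = 4 , 3 , <ᵇ⇒< 3 4 _ , ≤ᵇ⇒≤ 4 5 _ , refl
corner-representative (false , true  , true)  = 2 , 1 , <ᵇ⇒< 1 2 _ , ≤ᵇ⇒≤ 2 5 _ , refl
corner-representative (true  , false , false) = 5 , 1 , <ᵇ⇒< 1 5 _ , ≤ᵇ⇒≤ 5 5 _ , refl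
corner-representative (true  , false , true)  = 2 , 0 , <ᵇ⇒< 0 2 _ , ≤ᵇ⇒≤ 2 5 _ , refl
corner-representative (true  , true  , false) = 3 , 1 , <ᵇ⇒< 1 3 _ , ≤ᵇ⇒≤ 3 5 _ , refl
corner-representative (true  , true  , true)  = 1 , 0 , <ᵇ⇒< 0 1 _ , ≤ᵇ⇒≤ 1 5 _ , refl

block-bounds : ∀ {M q σ a b} → σ < q → q ≤ 5 → a < M → b < M →
               q * M + a < 6 * M × σ * M + b ≤ q * M + a
block-bounds {M} {q} {σ} {a} {b} σ<q q≤5 a<M b<M = row-bound , column-bound
  where
    open ≤-Reasoning
    row-bound : q * M + a < 6 * M
    row-bound = begin-strict
      q * M + a  <⟨ +-monoʳ-< (q * M) a<M ⟩
      q * M + M  ≡⟨ +-comm (q * M) M ⟩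
      suc q * M  ≤⟨ *-monoˡ-≤ M (s≤s q≤5) ⟩
      6 * M      ∎
    column-bound : σ * M + b ≤ q * M + a
    column-bound = begin
      σ * M + b  ≤⟨ +-monoʳ-≤ (σ * M) (<⇒≤ b<M) ⟩
      σ * M + M  ≡⟨ +-comm (σ * M) M ⟩
      suc σ * M  ≤⟨ *-monoˡ-≤ M σ<q ⟩
      q * M      ≤⟨ m≤m+n (q * M) a ⟩
      q * M + a  ∎

window-recurs : ∀ {M} .{{_ : NonZero M}} → Frobenius M → ∀ r j →
  ∃[ r' ] ∃[ j' ] (r' < 6 * M × j' ≤ r' ×
    (∀ {u v} → u < M → v < M → pascal₂ (r + u) (j + v) ≡ pascal₂ (r' + u) (j' + v)))
window-recurs {M} frob r j
  with corner-representative (corner (r / M) (j / M))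
... | q' , σ' , σ'<q' , q'≤5 , corner≡ =
  q' * M + a , σ' * M + b , proj₁ bounds , proj₂ bounds , same-window
  where
    a b : ℕ
    a = r % M
    b = j % M
    a<M : a < M
    a<M = m%n<n r M
    b<M : b < M
    b<M = m%n<n j M
    r≡ : r ≡ r / M * M + a
    r≡ = trans (m≡m%n+[m/n]*n r M) (+-comm a _)
    j≡ : j ≡ j / M * M + b
    j≡ = trans (m≡m%n+[m/n]*n j M) (+-comm b _)
    bounds : q' * M + a < 6 * M × σ' * M + b ≤ q' * M + a
    bounds = block-bounds σ'<q' q'≤5 a<M b<M
    same-window : ∀ {u v} → u < M → v < M →
                  pascal₂ (r + u) (j + v) ≡ pascal₂ (q' * M + a + u) (σ' * M + b + v)
    same-window {u} {v} u<M v<M = begin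
      pascal₂ (r + u) (j + v)
        ≡⟨ cong₂ (λ x y → pascal₂ (x + u) (y + v)) r≡ j≡ ⟩
      pascal₂ (r / M * M + a + u) (j / M * M + b + v)
        ≡⟨ cong₂ pascal₂ (+-assoc (r / M * M) a u) (+-assoc (j / M * M) b v) ⟩
      pascal₂ (r / M * M + (a + u)) (j / M * M + (b + v))
        ≡⟨ corner-determines frob (r / M) (j / M) q' σ' (sym corner≡)
             (+-mono-< a<M u<M) (+-mono-< b<M v<M) ⟩
      pascal₂ (q' * M + (a + u)) (σ' * M + (b + v))
        ≡⟨ cong₂ pascal₂ (+-assoc (q' * M) a u) (+-assoc (σ' * M) b v) ⟨
      pascal₂ (q' * M + a + u) (σ' * M + b + v) ∎
      where open ≡-Reasoning

-- A position (r , j) stands for the upward triangle (r , 2j).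
cellAt : ℕ × ℕ → ℕ × ℕ → Bool
cellAt x y = colour (proj₁ x + proj₁ y) (2 * proj₂ x + proj₂ y)

patternOf : List (ℕ × ℕ) → ℕ × ℕ → Pattern
patternOf D x = patternAt D (proj₁ x) (2 * proj₂ x)

Agree : List (ℕ × ℕ) → ℕ × ℕ → ℕ × ℕ → Set
Agree D x y = All (λ z → cellAt x z ≡ cellAt y z) D

Determines : List (ℕ × ℕ) → List (ℕ × ℕ) → Set
Determines D E = ∀ x y → Agree D x y → Agree E x y

patternOf-≡⇔Agree : ∀ D x y → patternOf D x ≡ patternOf D y ⇔ Agree D x y
patternOf-≡⇔Agree D x y = mk⇔ (map-≡⇒All D) map-cong-local

pascal₂-windows⇒Agree-S : ∀ m {r j r' j'} →
  (∀ {i t} → i < m → t ≤ i → pascal₂ (r + i) (j + t) ≡ pascal₂ (r' + i) (j' + t)) →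
  Agree (S m) (r , j) (r' , j')
pascal₂-windows⇒Agree-S m {r} {j} {r'} {j'} same = All.tabulate agree
  where
    agree : ∀ {z} → z ∈ S m → cellAt (r , j) z ≡ cellAt (r' , j') z
    agree {i , k} z∈ with ∈-staircase⁻ (λ i → suc (2 * i)) m z∈ | parity k
    ... | i<m , _          | odd t  = trans (colour-2*+1+2* (r + i) j t) (sym (colour-2*+1+2* (r' + i) j' t))
    ... | i<m , 2t<1+2i    | even t = begin
      colour (r + i) (2 * j + 2 * t)    ≡⟨ colour-2*+2* (r + i) j t ⟩
      pascal₂ (r + i) (j + t)           ≡⟨ same i<m (*-cancelˡ-≤ 2 (≤-pred 2t<1+2i)) ⟩
      pascal₂ (r' + i) (j' + t)         ≡⟨ colour-2*+2* (r' + i) j' t ⟨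
      colour (r' + i) (2 * j' + 2 * t)  ∎
      where open ≡-Reasoning

positions : ℕ → List (ℕ × ℕ)
positions N = staircase suc N

occurs⇔∈positions : ∀ m {D} → D ⊆ S m → ∀ p →
                    OccursWith D p ⇔ p ∈ map (patternOf D) (positions (6 * 2 ^ m))
occurs⇔∈positions m {D} D⊆S p = mk⇔ to from
  where
    N : ℕ
    N = 6 * 2 ^ m
    to : OccursWith D p → p ∈ map (patternOf D) (positions N)
    to (r , j , j≤r , refl)
      with window-recurs {{m^n≢0 2 m}} (frobenius-2^ m) r j
    ... | r' , j' , r'<N , j'≤r' , same = subst (_∈ map (patternOf D) (positions N)) pattern≡
          (∈-map⁺ (patternOf D) (∈-staircase⁺ suc N r'<N (s≤s j'≤r')))
      where
        i<2^m : ∀ {i} → i < m → i < 2 ^ m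
        i<2^m i<m = <-trans i<m (n<2^n m)
        same-below-m : ∀ {i t} → i < m → t ≤ i →
                       pascal₂ (r' + i) (j' + t) ≡ pascal₂ (r + i) (j + t)
        same-below-m i<m t≤i = sym (same (i<2^m i<m) (i<2^m (≤-<-trans t≤i i<m)))
        pattern≡ : patternOf D (r' , j') ≡ patternOf D (r , j)
        pattern≡ = Equivalence.from (patternOf-≡⇔Agree D (r' , j') (r , j))
                     (anti-mono D⊆S (pascal₂-windows⇒Agree-S m {r'} {j'} {r} {j} same-below-m))
    from : p ∈ map (patternOf D) (positions N) → OccursWith D p
    from p∈ with ∈-map⁻ (patternOf D) p∈
    ... | (r , j) , rj∈ , p≡ = r , j , ≤-pred (proj₂ (∈-staircase⁻ suc N rj∈)) , sym p≡

row : ℕ → List (ℕ × ℕ)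
row n = map (n ,_) (upTo (suc (2 * n)))

S-suc : ∀ n → S (suc n) ≡ S n ++ row n
S-suc n = begin
  concatMap rowOf (upTo (suc n))        ≡⟨ cong (concatMap rowOf) (upTo-∷ʳ n) ⟨
  concatMap rowOf (upTo n ++ n ∷ [])    ≡⟨ concatMap-++ rowOf (upTo n) (n ∷ []) ⟩
  S n ++ (row n ++ [])                  ≡⟨ cong (S n ++_) (++-identityʳ (row n)) ⟩
  S n ++ row n                          ∎
  where
    open ≡-Reasoning
    rowOf : ℕ → List (ℕ × ℕ)
    rowOf = λ i → map (i ,_) (upTo (suc (2 * i)))

cellEq-< : ∀ {i n} k l → i < n → cellEq (i , k) (n , l) ≡ false
cellEq-< {zero}  {suc n} k l _         = refl
cellEq-< {suc i} {suc n} k l (s≤s i<n) = cellEq-< k l i<n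

notApex : ℕ × ℕ → Bool
notApex x = not (cellEq x (0 , 0))

-- Written as the filter of bottomCutDom (suc n), so that it matches it definitionally
-- (2 * suc n ∸ 2 is 2n).
notBottomCorner : ℕ → ℕ × ℕ → Bool
notBottomCorner n x = not (cellEq x (n , 0) ∨ cellEq x (n , 2 * suc n ∸ 2))

innerRow : ℕ → List (ℕ × ℕ)
innerRow n = filterᵇ (notBottomCorner n) (row n)

bottomCutDom-suc : ∀ n → bottomCutDom (suc n) ≡ S n ++ innerRow n
bottomCutDom-suc n = begin
  filterᵇ p (S (suc n))          ≡⟨ cong (filterᵇ p) (S-suc n) ⟩
  filterᵇ p (S n ++ row n)       ≡⟨ filter-++ (T? ∘ p) (S n) (row n) ⟩
  filterᵇ p (S n) ++ innerRow n  ≡⟨ cong (_++ innerRow n) (filter-all (T? ∘ p) (All.tabulate above)) ⟩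
  S n ++ innerRow n              ∎
  where
    open ≡-Reasoning
    p : ℕ × ℕ → Bool
    p = notBottomCorner n
    above : ∀ {x} → x ∈ S n → T (p x)
    above {i , k} x∈ with i<n , _ ← ∈-staircase⁻ (λ i → suc (2 * i)) n x∈
      rewrite cellEq-< k 0 i<n | cellEq-< k (2 * suc n ∸ 2) i<n = tt

allCutDom-suc : ∀ n → allCutDom (suc (suc n)) ≡ topCutDom (suc n) ++ innerRow (suc n)
allCutDom-suc n = begin
  filterᵇ notCut (S (suc m))                       ≡⟨ cong (filterᵇ notCut) (S-suc m) ⟩
  filterᵇ notCut (S m ++ row m)                    ≡⟨ filter-++ (T? ∘ notCut) (S m) (row m) ⟩
  filterᵇ notCut (S m) ++ filterᵇ notCut (row m)   ≡⟨ cong₂ _++_ (filterᵇ-cong-local (S m) above)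
                                                                (filterᵇ-cong-local (row m) bottom) ⟩
  topCutDom m ++ innerRow m                        ∎
  where
    open ≡-Reasoning
    m : ℕ
    m = suc n
    notCut : ℕ × ℕ → Bool
    notCut x = not (cellEq x (0 , 0) ∨ cellEq x (m , 0) ∨ cellEq x (m , 2 * suc m ∸ 2))
    above : ∀ {x} → x ∈ S m → notCut x ≡ notApex x
    above {i , k} x∈ with i<m , _ ← ∈-staircase⁻ (λ i → suc (2 * i)) m x∈
      rewrite cellEq-< k 0 i<m | cellEq-< k (2 * suc m ∸ 2) i<m = cong not (∨-identityʳ _)
    bottom : ∀ {x} → x ∈ row m → notCut x ≡ notBottomCorner m x
    bottom x∈ with _ , _ , refl ← ∈-map⁻ (m ,_) x∈ = refl

T-cellEq : ∀ {x y} → x ≡ y → T (cellEq x y)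
T-cellEq {i , k} refl = Equivalence.from T-∧ (≡⇒≡ᵇ i i refl , ≡⇒≡ᵇ k k refl)

notBottomCorner⇒≢ : ∀ n {x} → T (notBottomCorner n x) → x ≢ (n , 0) × x ≢ (n , 2 * suc n ∸ 2)
notBottomCorner⇒≢ n {x} notBottomCorner-x =
  (atCorner ∘ inj₁ ∘ T-cellEq) , (atCorner ∘ inj₂ ∘ T-cellEq)
  where
    atCorner : ¬ (T (cellEq x (n , 0)) ⊎ T (cellEq x (n , 2 * suc n ∸ 2)))
    atCorner = subst T (Equivalence.to T-not-≡ notBottomCorner-x) ∘ Equivalence.from T-∨

∈-innerRow⁻ : ∀ n {i k} → (i , k) ∈ innerRow n → i ≡ n × 0 < k × k < 2 * n
∈-innerRow⁻ n ik∈ with ∈-filter⁻ (T? ∘ notBottomCorner n) {xs = row n} ik∈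
... | ik∈row , notBottomCorner-ik with ∈-map⁻ (n ,_) ik∈row
... | k , k∈ , refl with notBottomCorner⇒≢ n notBottomCorner-ik
... | ≢left , ≢right =
  refl , n≢0⇒n>0 (≢left ∘ cong (n ,_)) , ≤∧≢⇒< (≤-pred (∈-upTo⁻ k∈)) k≢2n
  where
    k≢2n : k ≢ 2 * n
    k≢2n k≡2n = ≢right (cong (n ,_) (trans k≡2n (sym (cong (_∸ 2) (*-suc 2 n)))))

innerRow-determined : ∀ n {D} → (∀ {t} → t < n → (n , 2 * t) ∈ D × (n , 2 * suc t) ∈ D) →
                      Determines D (innerRow (suc n))
innerRow-determined n {D} row⊆D (r , j) (r' , j') agree = All.tabulate determined
  where
    pascal-agree : ∀ {t} → (n , 2 * t) ∈ D → pascal₂ (r + n) (j + t) ≡ pascal₂ (r' + n) (j' + t)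
    pascal-agree {t} nt∈D = begin
      pascal₂ (r + n) (j + t)          ≡⟨ colour-2*+2* (r + n) j t ⟨
      colour (r + n) (2 * j + 2 * t)   ≡⟨ All.lookup agree nt∈D ⟩
      colour (r' + n) (2 * j' + 2 * t) ≡⟨ colour-2*+2* (r' + n) j' t ⟩
      pascal₂ (r' + n) (j' + t)        ∎
      where open ≡-Reasoning
    pascal-rule : ∀ r j t → colour (r + suc n) (2 * j + 2 * suc t)
                            ≡ pascal₂ (r + n) (j + t) xor pascal₂ (r + n) (j + suc t)
    pascal-rule r j t = begin
      colour (r + suc n) (2 * j + 2 * suc t)
        ≡⟨ colour-2*+2* (r + suc n) j (suc t) ⟩
      pascal₂ (r + suc n) (j + suc t)
        ≡⟨ cong₂ pascal₂ (+-suc r n) (+-suc j t) ⟩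
      pascal₂ (suc (r + n)) (suc (j + t))
        ≡⟨ cong (λ s → pascal₂ (r + n) (j + t) xor pascal₂ (r + n) s) (+-suc j t) ⟨
      pascal₂ (r + n) (j + t) xor pascal₂ (r + n) (j + suc t) ∎
      where open ≡-Reasoning
    determined : ∀ {z} → z ∈ innerRow (suc n) → cellAt (r , j) z ≡ cellAt (r' , j') z
    determined {i , k} z∈ with ∈-innerRow⁻ (suc n) z∈ | parity k
    ... | refl , _ , _ | odd t =
      trans (colour-2*+1+2* (r + suc n) j t) (sym (colour-2*+1+2* (r' + suc n) j' t))
    ... | refl , () , _ | even zero
    ... | refl , _ , 2+2t<2+2n | even (suc t)
      with row⊆D (≤-pred (*-cancelˡ-< 2 (suc t) (suc n) 2+2t<2+2n))
    ... | left∈D , right∈D =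
      trans (pascal-rule r j t)
            (trans (cong₂ _xor_ (pascal-agree left∈D) (pascal-agree right∈D))
                   (sym (pascal-rule r' j' t)))

determined-extension-same-kernel : ∀ {D E} → Determines D E → ∀ x y →
  patternOf D x ≡ patternOf D y ⇔ patternOf (D ++ E) x ≡ patternOf (D ++ E) y
determined-extension-same-kernel {D} {E} determined x y =
  ⇔-sym (patternOf-≡⇔Agree (D ++ E) x y) ⇔-∘ (agree⇔ ⇔-∘ patternOf-≡⇔Agree D x y)
  where
    agree⇔ : Agree D x y ⇔ Agree (D ++ E) x y
    agree⇔ = mk⇔ (λ agreeD → ++⁺ agreeD (determined x y agreeD)) (proj₁ ∘ ++⁻ D)

determined-extension-same-count :
  ∀ m {D E D′} → D′ ≡ D ++ E → D′ ⊆ S m → Determines D E →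
  ∃[ k ] (HasCount (OccursWith D) k × HasCount (OccursWith D′) k)
determined-extension-same-count m {D} {E} refl D′⊆S determined =
  let k , countD , countD′ = same-kernel⇒same-count (patternOf D) (patternOf (D ++ E))
                               (determined-extension-same-kernel determined) (positions (6 * 2 ^ m))
  in k , HasCount-resp-⇔ (occurs⇔∈positions m (D′⊆S ∘ xs⊆xs++ys D E)) countD
       , HasCount-resp-⇔ (occurs⇔∈positions m D′⊆S) countD′

lastRow∈S : ∀ {n t} → t < n → (n , 2 * t) ∈ S (suc n) × (n , 2 * suc t) ∈ S (suc n)
lastRow∈S {n} t<n =
  ∈-staircase⁺ (λ i → suc (2 * i)) (suc n) ≤-refl (s≤s (*-monoʳ-≤ 2 (<⇒≤ t<n))) ,
  ∈-staircase⁺ (λ i → suc (2 * i)) (suc n) ≤-refl (s≤s (*-monoʳ-≤ 2 t<n))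

lastRow∈topCutDom : ∀ {n t} → t < n →
                    (n , 2 * t) ∈ topCutDom (suc n) × (n , 2 * suc t) ∈ topCutDom (suc n)
-- t < n forces n ≥ 1, so these cells are not the apex (0 , 0).
lastRow∈topCutDom t<n@(s≤s _) with left∈ , right∈ ← lastRow∈S t<n =
  ∈-filter⁺ (T? ∘ notApex) left∈ tt , ∈-filter⁺ (T? ∘ notApex) right∈ tt

bottomCutDom⊆S : ∀ m → bottomCutDom m ⊆ S m
bottomCutDom⊆S m = filter-⊆ _ (S m)

allCutDom⊆S : ∀ m → allCutDom m ⊆ S m
allCutDom⊆S m = filter-⊆ _ (S m)

lemma13 : (n : ℕ) → 2 ≤ n →
    (∃[ k ] (IsA n k × IsC (n + 1) k)) × (∃[ k ] (IsB n k × IsD (n + 1) k))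
lemma13 zero ()
lemma13 (suc n) _ rewrite +-comm n 1 =
  determined-extension-same-count (suc (suc n)) (bottomCutDom-suc (suc n)) (bottomCutDom⊆S (suc (suc n)))
    (innerRow-determined n lastRow∈S) ,
  determined-extension-same-count (suc (suc n)) (allCutDom-suc n) (allCutDom⊆S (suc (suc n)))
    (innerRow-determined n lastRow∈topCutDom)
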